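{- For all states $i,s$ of an LTS with inputs and outputs, $i \mathrel{\mathsf{iocos}} s$ holds if and only if for every formula $\phi\in\mathcal L_{\mathsf{iocos}}$, $i\models\phi$ implies $s\models\phi$.
   Context: Fix disjoint finite sets $I$ of input actions (written $a?,b?,\dots$) and $O$ of output actions (written $a!,b!,\dots$), where $O$ contains a distinguished quiescence action $\delta!$; let $L=I\cup O$. An LTS with inputs and outputs is a tuple $(S,I,O,\to)$ with $S$ a set of states and $\to\subseteq S\times L\times S$ (write $p\xrightarrow{a}p'$), such that for all $p,p'$: $p\xrightarrow{\delta!}p'$ iff $p=p'$ and $p$ has no $a!$-transition for any $a!\in O\setminus\{\delta!\}$. Throughout, LTSs are image-finite: for each $p$ and $a\in L$ there are finitely many $p'$ with $p\xrightarrow{a}p'$. Let $\mathsf{ins}(p)=\{a?\in I \mid \exists p'.\,p\xrightarrow{a?}p'\}$. A relation $R\subseteq S\times S$ is an iocos-relation if for every $(p,q)\in R$: (1) $\mathsf{ins}(q)\subseteq\mathsf{ins}(p)$; (2) for every $a?\in\mathsf{ins}(q)$ and every $p'$ with $p\xrightarrow{a?}p'$ there is $q'$ with $q\xrightarrow{a?}q'$ and $(p',q')\in R$; (3) for every $a!\in O$ and every $p'$ with $p\xrightarrow{a!}p'$ there is $q'$ with $q\xrightarrow{a!}q'$ and $(p',q')\in R$. The relation $\mathsf{iocos}$ is the union of all iocos-relations. The logic $\mathcal L_{\mathsf{iocos}}$ has formulae $\phi::=\mathrm{tt}\mid\mathrm{ff}\mid\phi\wedge\phi\mid\phi\vee\phi\mid\langle\!\langle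 a?\rangle\!\rangle\phi\mid\langle a!\rangle\phi$ with $a?\in I$, $a!\in O$; the constants and Boolean connectives have the usual meaning, $p\models\langle a!\rangle\phi$ iff there is $p'$ with $p\xrightarrow{a!}p'$ and $p'\models\phi$, and $p\models\langle\!\langle a?\rangle\!\rangle\phi$ iff either $p$ has no $a?$-transition or there is $p'$ with $p\xrightarrow{a?}p'$ and $p'\models\phi$. -}

module Defs where

open import Data.Nat using (ℕ; suc)
open import Data.Fin using (Fin; zero)
open import Data.Sum using (_⊎_; inj₁; inj₂)
open import Data.Product using (Σ; ∃; _×_; _,_)
open import Data.Empty using (⊥)
open import Data.Unit using (⊤)
open import Data.List using (List)
open import Data.List.Membership.Propositional using (_∈_)
open import Relation.Nullary using (¬_)
open import Relation.Binary.PropositionalEquality using (_≡_)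
open import Function.Bundles using (_⇔_)

module _ (nI nO : ℕ) where

  In : Set
  In = Fin nI

  Out : Set
  Out = Fin (suc nO)

  δ : Out
  δ = zero

  Act : Set
  Act = In ⊎ Out

  record LTS : Set₁ where
    field
      State : Set
      _⟶[_]_ : State → Act → State → Set
      quiescence : ∀ p p' → (p ⟶[ inj₂ δ ] p') ⇔
                   (p ≡ p' × (∀ (a : Out) → ¬ (a ≡ δ) → ∀ p'' → ¬ (p ⟶[ inj₂ a ] p'')))
      imageFinite : ∀ p (a : Act) → Σ (List State) λ succs → ∀ p' → (p ⟶[ a ] p') ⇔ (p' ∈ succs)

  module _ (M : LTS) where
    open LTS M

    _∈ins_ : In → State → Set
    a ∈ins p = ∃ λ p' → p ⟶[ inj₁ a ] p'

    IsIocosRelation : (State → State → Set) → Set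
    IsIocosRelation R = ∀ p q → R p q →
        (∀ a → a ∈ins q → a ∈ins p)
      × (∀ a → a ∈ins q → ∀ p' → p ⟶[ inj₁ a ] p' → ∃ λ q' → q ⟶[ inj₁ a ] q' × R p' q')
      × (∀ (a : Out) p' → p ⟶[ inj₂ a ] p' → ∃ λ q' → q ⟶[ inj₂ a ] q' × R p' q')

    iocos : State → State → Set₁
    iocos p q = Σ (State → State → Set) λ R → IsIocosRelation R × R p q

  data Formula : Set where
    tt ff : Formula
    _∧_ _∨_ : Formula → Formula → Formula
    ⟪_⟫_ : In → Formula → Formula
    ⟨_⟩_ : Out → Formula → Formula

  module _ (M : LTS) where
    open LTS M

    _⊨_ : State → Formula → Set
    p ⊨ tt = ⊤
    p ⊨ ff = ⊥
    p ⊨ (φ ∧ ψ) = p ⊨ φ × p ⊨ ψ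
    p ⊨ (φ ∨ ψ) = p ⊨ φ ⊎ p ⊨ ψ
    p ⊨ (⟪ a ⟫ φ) = (¬ ∃ λ p' → p ⟶[ inj₁ a ] p') ⊎ (∃ λ p' → p ⟶[ inj₁ a ] p' × p' ⊨ φ)
    p ⊨ (⟨ a ⟩ φ) = ∃ λ p' → p ⟶[ inj₂ a ] p' × p' ⊨ φ

-- Formulae are transported along any iocos-relation; conversely, the logical
-- preorder p ⊑ q is itself an iocos-relation.  If p ⟶α p' had no ⊑-match among
-- the finitely many α-successors q₁ … qₙ of q, classically each qᵢ fails some φᵢ
-- true at p', and p ⊨ ⟨α⟩(φ₁ ∧ … ∧ φₙ) would then fail at q.
module Submission where

open import Defs
open import Data.Nat using (ℕ)
open import Data.Product using (∃; _×_; _,_; proj₁)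
open import Data.Sum using (_⊎_; inj₁; inj₂)
open import Data.Empty using (⊥; ⊥-elim)
open import Data.Unit using (tt)
open import Data.List using (List; []; _∷_)
open import Data.List.Membership.Propositional using (_∈_)
open import Data.List.Relation.Unary.Any using (here; there)
open import Data.List.Relation.Unary.All as All using (All; []; _∷_)
open import Relation.Nullary using (¬_; Dec; yes; no)
open import Relation.Binary.PropositionalEquality using (refl)
open import Function.Bundles using (Equivalence)
open import Function using (case_of_)
open import Level using (0ℓ)
open import Axiom.ExcludedMiddle using (ExcludedMiddle)

module _ {nI nO : ℕ} (M : LTS nI nO) where
  open LTS M

  _⊧_ : State → Formula nI nO → Set
  _⊧_ = _⊨_ nI nO M

  _⊑_ : State → State → Set
  p ⊑ q = ∀ φ → p ⊧ φ → q ⊧ φ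

  -- Image-finiteness makes ins(q) decidable, so soundness needs no excluded middle.
  ins? : ∀ a q → Dec (_∈ins_ nI nO M a q)
  ins? a q with imageFinite q (inj₁ a)
  ... | [] , succs = no λ (q' , t) → case Equivalence.to (succs q') t of λ ()
  ... | q' ∷ _ , succs = yes (q' , Equivalence.from (succs q') (here refl))

  iocosRelation⇒⊧-preserved : ∀ {R} → IsIocosRelation nI nO M R →
                              ∀ {p q} → R p q → ∀ φ → p ⊧ φ → q ⊧ φ
  iocosRelation⇒⊧-preserved isR {p} {q} pRq = go
    where
    go : ∀ φ → p ⊧ φ → q ⊧ φ
    go tt _ = tt
    go (φ ∧ ψ) (pφ , pψ) = iocosRelation⇒⊧-preserved isR pRq φ pφ
                         , iocosRelation⇒⊧-preserved isR pRq ψ pψ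
    go (φ ∨ ψ) (inj₁ pφ) = inj₁ (iocosRelation⇒⊧-preserved isR pRq φ pφ)
    go (φ ∨ ψ) (inj₂ pψ) = inj₂ (iocosRelation⇒⊧-preserved isR pRq ψ pψ)
    go (⟪ a ⟫ φ) (inj₁ p↛a) = inj₁ λ q→a → p↛a (proj₁ (isR p q pRq) a q→a)
    go (⟪ a ⟫ φ) (inj₂ (p' , p→p' , p'φ)) with ins? a q
    ... | no q↛a = inj₁ q↛a
    ... | yes q→a with isR p q pRq
    ...   | _ , match , _ with match a q→a p' p→p'
    ...     | q' , q→q' , p'Rq' =
              inj₂ (q' , q→q' , iocosRelation⇒⊧-preserved isR p'Rq' φ p'φ)
    go (⟨ a ⟩ φ) (p' , p→p' , p'φ) with isR p q pRq
    ... | _ , _ , match with match a p' p→p'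
    ...   | q' , q→q' , p'Rq' = q' , q→q' , iocosRelation⇒⊧-preserved isR p'Rq' φ p'φ

  module Classical (em : ExcludedMiddle 0ℓ) where

    ¬¬-elim : {P : Set} → ¬ ¬ P → P
    ¬¬-elim {P} ¬¬p with em {P}
    ... | yes p = p
    ... | no ¬p = ⊥-elim (¬¬p ¬p)

    ⋢⇒distinguishing : ∀ {p q} → ¬ p ⊑ q → ∃ λ φ → p ⊧ φ × ¬ q ⊧ φ
    ⋢⇒distinguishing p⋢q =
      ¬¬-elim λ ¬φ → p⋢q λ φ pφ → ¬¬-elim λ ¬qφ → ¬φ (φ , pφ , ¬qφ)

    ⊑-some-or-distinguishing-all : ∀ p (qs : List State) →
      (∃ λ q → q ∈ qs × p ⊑ q) ⊎ (∃ λ φ → p ⊧ φ × All (λ q → ¬ q ⊧ φ) qs)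
    ⊑-some-or-distinguishing-all p [] = inj₂ (tt , tt , [])
    ⊑-some-or-distinguishing-all p (q ∷ qs) with em {p ⊑ q}
    ... | yes p⊑q = inj₁ (q , here refl , p⊑q)
    ... | no p⋢q with ⊑-some-or-distinguishing-all p qs
    ...   | inj₁ (q' , q'∈qs , p⊑q') = inj₁ (q' , there q'∈qs , p⊑q')
    ...   | inj₂ (ψ , pψ , ¬qsψ) with ⋢⇒distinguishing p⋢q
    ...     | φ , pφ , ¬qφ =
              inj₂ (φ ∧ ψ , (pφ , pψ) , (λ (qφ , _) → ¬qφ qφ)
                                      ∷ All.map (λ ¬q'ψ (_ , q'ψ) → ¬q'ψ q'ψ) ¬qsψ)

    ⊑-successor : ∀ q α p' → (∀ φ → p' ⊧ φ → ∃ λ q' → q ⟶[ α ] q' × q' ⊧ φ) →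
                  ∃ λ q' → q ⟶[ α ] q' × p' ⊑ q'
    ⊑-successor q α p' reach with imageFinite q α
    ... | qs , succs with ⊑-some-or-distinguishing-all p' qs
    ...   | inj₁ (q' , q'∈qs , p'⊑q') = q' , Equivalence.from (succs q') q'∈qs , p'⊑q'
    ...   | inj₂ (φ , p'φ , ¬qsφ) with reach φ p'φ
    ...     | q' , q→q' , q'φ =
              ⊥-elim (All.lookup ¬qsφ (Equivalence.to (succs q') q→q') q'φ)

    ⊑-isIocosRelation : IsIocosRelation nI nO M _⊑_
    ⊑-isIocosRelation p q p⊑q = insInclusion , inputMatch , outputMatch
      where
      insInclusion : ∀ a → _∈ins_ nI nO M a q → _∈ins_ nI nO M a p
      insInclusion a q→a = ¬¬-elim λ p↛a → refute (p⊑q (⟪ a ⟫ ff) (inj₁ p↛a))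
        where
        refute : ¬ q ⊧ (⟪ a ⟫ ff)
        refute (inj₁ q↛a) = q↛a q→a
        refute (inj₂ (_ , _ , ()))

      inputMatch : ∀ a → _∈ins_ nI nO M a q → ∀ p' → p ⟶[ inj₁ a ] p' →
                   ∃ λ q' → q ⟶[ inj₁ a ] q' × p' ⊑ q'
      inputMatch a q→a p' p→p' = ⊑-successor q (inj₁ a) p' reach
        where
        reach : ∀ φ → p' ⊧ φ → ∃ λ q' → q ⟶[ inj₁ a ] q' × q' ⊧ φ
        reach φ p'φ with p⊑q (⟪ a ⟫ φ) (inj₂ (p' , p→p' , p'φ))
        ... | inj₁ q↛a = ⊥-elim (q↛a q→a)
        ... | inj₂ q'φ = q'φ

      outputMatch : ∀ a p' → p ⟶[ inj₂ a ] p' → ∃ λ q' → q ⟶[ inj₂ a ] q' × p' ⊑ q'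
      outputMatch a p' p→p' =
        ⊑-successor q (inj₂ a) p' λ φ p'φ → p⊑q (⟨ a ⟩ φ) (p' , p→p' , p'φ)

theorem1 : ExcludedMiddle 0ℓ → (nI nO : ℕ) (M : LTS nI nO) (i s : LTS.State M) →
           (iocos nI nO M i s → (∀ φ → _⊨_ nI nO M i φ → _⊨_ nI nO M s φ))
           × ((∀ φ → _⊨_ nI nO M i φ → _⊨_ nI nO M s φ) → iocos nI nO M i s)
theorem1 em nI nO M i s =
    (λ (R , isR , iRs) → iocosRelation⇒⊧-preserved M isR iRs)
  , (λ i⊑s → _⊑_ M , Classical.⊑-isIocosRelation M em , i⊑s)
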